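{- Let $M$ be a maximum induced matching of the grid $G_{5,5}$. Suppose that at most two vertices of the column $V_1=\{u_1v_1,\dots,u_5v_1\}$ are saturated by $M$, and that these saturated vertices are two adjacent vertices. Then at least three vertices of the column $V_5=\{u_1v_5,\dots,u_5v_5\}$ are saturated by $M$, and two of them are adjacent.
   Context: For integers $n,m\geq 2$, the grid $G_{n,m}$ is the Cartesian product of the path $P_n=u_1u_2\cdots u_n$ and the path $P_m=v_1v_2\cdots v_m$; its vertices are written $u_iv_j$ ($1\le i\le n$, $1\le j\le m$), and $u_iv_j$, $u_kv_l$ are adjacent iff either $i=k$ and $|j-l|=1$, or $j=l$ and $|i-k|=1$. An induced matching of a graph $G$ is a set $M$ of pairwise vertex-disjoint edges such that no edge of $G$ joins endpoints of two distinct edges of $M$; a maximum induced matching is one of largest possible size. A vertex is saturated by $M$ if it is an endpoint of an edge of $M$. -}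

module Defs where

open import Data.Nat using (ℕ; suc; _≤_)
open import Data.Fin using (Fin; toℕ)
open import Data.Product using (_×_; _,_; proj₁; proj₂; ∃-syntax)
open import Data.Sum using (_⊎_)
open import Data.List using (List; length; lookup)
open import Data.List.Relation.Unary.Any using (Any)
open import Relation.Binary.PropositionalEquality using (_≡_; _≢_)
open import Relation.Nullary using (¬_)

-- Vertex u_i v_j of the grid G_{n,m} = P_n □ P_m, with i, j 0-indexed:
-- (i , j) : Fin n × Fin m stands for u_{i+1} v_{j+1}.
Vertex : ℕ → ℕ → Set
Vertex n m = Fin n × Fin m

PathAdj : {k : ℕ} → Fin k → Fin k → Set
PathAdj a b = suc (toℕ a) ≡ toℕ b ⊎ suc (toℕ b) ≡ toℕ a

Adj : {n m : ℕ} → Vertex n m → Vertex n m → Set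
Adj (i , j) (k , l) = (i ≡ k × PathAdj j l) ⊎ (j ≡ l × PathAdj i k)

Edge : ℕ → ℕ → Set
Edge n m = Vertex n m × Vertex n m

Endpoint : {n m : ℕ} → Vertex n m → Edge n m → Set
Endpoint x e = x ≡ proj₁ e ⊎ x ≡ proj₂ e

-- It is an induced
-- matching when every listed pair is an edge of the grid and any two
-- entries at distinct positions are vertex-disjoint and no grid edge joins
-- an endpoint of one to an endpoint of the other.  (Distinct positions
-- being vertex-disjoint also rules out repeated edges, so length = |M|.)
IsInducedMatching : {n m : ℕ} → List (Edge n m) → Set
IsInducedMatching {n} {m} M =
  ((p : Fin (length M)) → Adj (proj₁ (lookup M p)) (proj₂ (lookup M p))) ×
  ((p q : Fin (length M)) → p ≢ q →
     (x y : Vertex n m) → Endpoint x (lookup M p) → Endpoint y (lookup M q) →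
     x ≢ y × ¬ Adj x y)

IsMaximumInducedMatching : {n m : ℕ} → List (Edge n m) → Set
IsMaximumInducedMatching {n} {m} M =
  IsInducedMatching M ×
  ((M' : List (Edge n m)) → IsInducedMatching M' → length M' ≤ length M)

Saturated : {n m : ℕ} → List (Edge n m) → Vertex n m → Set
Saturated M x = Any (Endpoint x) M

-- An explicit induced matching with six edges shows that a maximum induced
-- matching of G₅,₅ has at least six edges.  Listing every grid edge once, in
-- one fixed orientation, each induced matching is represented by a sublist of
-- that list whose entries are pairwise compatible and which saturates the same
-- vertices.  The claim is then a finite check over all such sublists with at
-- least six entries, done by a depth-first search that abandons a branch as
-- soon as too few candidates are left to reach six.
module Submission where

open import Defs
open import Data.Fin using (Fin)
open import Data.Fin using (zero; suc)
open import Data.Product using (_×_; _,_; ∃-syntax)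
open import Data.Sum using (_⊎_)
open import Data.List using (List)
open import Relation.Binary.PropositionalEquality using (_≡_; _≢_)

open import Data.Bool using (Bool; true; false; T; _∧_)
open import Data.Unit using (tt)
open import Data.Bool.Properties using (T-∧)
open import Data.Empty using (⊥-elim)
open import Data.Fin using (toℕ; #_; _≟_)
open import Data.Fin.Properties using (all?; any?; injective⇒≤)
open import Data.List using ([]; _∷_; _++_; _∷ʳ_; length; lookup; filter; allFin; cartesianProduct)
open import Data.List.Properties using (++-identityʳ; ∷ʳ-++; length-++; filter-all)
open import Data.List.Membership.Propositional using (_∈_; find; lose)
open import Data.List.Membership.Propositional.Properties using (∈-filter⁺; ∈-filter⁻; ∈-cartesianProduct⁺; ∈-allFin; ∈-lookup)
open import Data.List.Relation.Binary.Sublist.Propositional using (_⊆_; []; _∷_)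
import Data.List.Relation.Binary.Sublist.Propositional as Sublist
open import Data.List.Relation.Binary.Sublist.Propositional.Properties using (filter-⊆; length-mono-≤)
import Data.List.Relation.Binary.Sublist.Propositional.Properties as SublistProperties
open import Data.List.Relation.Unary.All using (All; []; _∷_)
import Data.List.Relation.Unary.All as All
open import Data.List.Relation.Unary.All.Properties using (all-filter)
open import Data.List.Relation.Unary.AllPairs using (AllPairs; []; _∷_)
open import Data.List.Relation.Unary.Any using (Any; index)
import Data.List.Relation.Unary.Any as Any
open import Data.List.Relation.Unary.Any.Properties using (lookup-index)
import Data.List.Relation.Unary.AllPairs.Properties as AllPairs
import Data.List.Relation.Unary.Unique.Propositional.Properties as Unique
open import Data.Nat as ℕ using (ℕ; _≤_; _<?_)
open import Data.Nat.Properties using (≤-trans; ≤-reflexive; <-asym; 1+n≢n; +-monoʳ-≤; <⇒≱)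
open import Data.Product using (proj₁; proj₂; swap; uncurry)
open import Data.Product.Properties using (≡-dec)
import Data.Sum as Sum
open import Data.Sum using (inj₁; inj₂)
open import Function.Bundles using (_⇔_; mk⇔; Equivalence)
open import Relation.Binary.Definitions using (Decidable; DecidableEquality)
open import Relation.Binary.PropositionalEquality using (refl; sym; trans; cong; subst)
open import Relation.Nullary using (¬_; Dec; yes; no)
open import Relation.Nullary.Decidable using (⌊_⌋; toWitness; from-yes; map′; ¬?; _×-dec_; _⊎-dec_; _→-dec_)
import Relation.Unary as U

private
  variable
    n m : ℕ
    x y : Vertex n m
    e f e′ f′ : Edge n m

allPairs-zipWith-All : {A : Set} {P : A → Set} {R Q : A → A → Set} {xs : List A} →
                       (∀ {a b} → P a → P b → R a b → Q a b) →
                       All P xs → AllPairs R xs → AllPairs Q xs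
allPairs-zipWith-All strengthen [] [] = []
allPairs-zipWith-All strengthen (pa ∷ ps) (ra ∷ rs) =
  All.zipWith (λ (pb , rab) → strengthen pa pb rab) (ps , ra) ∷ allPairs-zipWith-All strengthen ps rs

⊆-filter : {A : Set} {P : A → Set} (P? : U.Decidable P) {xs ys : List A} →
           xs ⊆ ys → All P xs → xs ⊆ filter P? ys
⊆-filter {P = P} P? xs⊆ys pxs =
  subst (_⊆ _) (filter-all P? pxs) (SublistProperties.filter⁺ P? P? (subst P) xs⊆ys)

module CliqueSearch {A : Set} {R : A → A → Set} (R? : Decidable R)
                    {Goal : List A → Set} (Goal? : U.Decidable Goal) (size : ℕ) where

  -- Choosing e discards the candidates incompatible with e, so the chosen list is
  -- always a clique; a branch is cut once it cannot reach size elements.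
  search : ℕ → List A → List A → Bool
  search fuel es chosen with length chosen ℕ.+ length es <? size
  ... | yes _ = true
  search _ [] chosen | no _ = ⌊ Goal? chosen ⌋
  search ℕ.zero (_ ∷ _) _ | no _ = false
  search (ℕ.suc fuel) (e ∷ es) chosen | no _ =
    search fuel es chosen ∧ search fuel (filter (R? e) es) (chosen ∷ʳ e)

  search-sound : ∀ fuel {es S} chosen → S ⊆ es → AllPairs R S →
                 size ≤ length (chosen ++ S) → T (search fuel es chosen) → Goal (chosen ++ S)
  search-sound fuel {es} {S} chosen S⊆ _ big _ with length chosen ℕ.+ length es <? size
  ... | yes short = ⊥-elim (<⇒≱ short (≤-trans big reachable))
    where
    reachable : length (chosen ++ S) ≤ length chosen ℕ.+ length es
    reachable = subst (_≤ _) (sym (length-++ chosen)) (+-monoʳ-≤ (length chosen) (length-mono-≤ S⊆))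
  search-sound _ chosen [] _ _ found | no _ =
    subst Goal (sym (++-identityʳ chosen)) (toWitness found)
  search-sound ℕ.zero chosen (_ Sublist.∷ʳ _) _ _ () | no _
  search-sound ℕ.zero chosen (_ ∷ _) _ _ () | no _
  search-sound (ℕ.suc fuel) chosen (e Sublist.∷ʳ S⊆) clique big found | no _ =
    search-sound fuel chosen S⊆ clique big (proj₁ (Equivalence.to T-∧ found))
  search-sound (ℕ.suc fuel) {e ∷ es} {e ∷ S} chosen (refl ∷ S⊆) (compatible ∷ clique) big found | no _ =
    subst Goal (∷ʳ-++ chosen e S)
      (search-sound fuel (chosen ∷ʳ e) (⊆-filter (R? e) S⊆ compatible) clique
        (subst (size ≤_) (cong length (sym (∷ʳ-++ chosen e S))) big)
        (proj₂ (Equivalence.to T-∧ found)))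

  -- Running out of fuel yields false, so the fuel only matters for completeness;
  -- length es suffices because filtering never lengthens the candidates.
  searchFrom : List A → Bool
  searchFrom es = search (length es) es []

  searchFrom-sound : ∀ {es S} → S ⊆ es → AllPairs R S → size ≤ length S → searchFrom es ≡ true → Goal S
  searchFrom-sound S⊆ clique big found = search-sound _ [] S⊆ clique big (subst T (sym found) tt)

_≟ᵥ_ : DecidableEquality (Vertex n m)
_≟ᵥ_ = ≡-dec _≟_ _≟_

pathAdj? : {k : ℕ} → Decidable (PathAdj {k})
pathAdj? a b = (ℕ.suc (toℕ a) ℕ.≟ toℕ b) ⊎-dec (ℕ.suc (toℕ b) ℕ.≟ toℕ a)

adj? : Decidable (Adj {n} {m})
adj? (i , j) (k , l) = ((i ≟ k) ×-dec pathAdj? j l) ⊎-dec ((j ≟ l) ×-dec pathAdj? i k)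

endpoint? : (x : Vertex n m) (e : Edge n m) → Dec (Endpoint x e)
endpoint? x (y , z) = (x ≟ᵥ y) ⊎-dec (x ≟ᵥ z)

saturated? : (M : List (Edge n m)) → U.Decidable (Saturated M)
saturated? M x = Any.any? (endpoint? x) M

infix 4 _≈_
_≈_ : Edge n m → Edge n m → Set
e ≈ f = e ≡ f ⊎ swap e ≡ f

_≈?_ : Decidable (_≈_ {n} {m})
e ≈? f = (e ≟ₑ f) ⊎-dec (swap e ≟ₑ f)
  where
  _≟ₑ_ : DecidableEquality (Edge _ _)
  _≟ₑ_ = ≡-dec _≟ᵥ_ _≟ᵥ_

≈-sym : e ≈ f → f ≈ e
≈-sym (inj₁ refl) = inj₁ refl
≈-sym (inj₂ refl) = inj₂ refl

≈-trans : e ≈ f → f ≈ e′ → e ≈ e′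
≈-trans (inj₁ refl) f≈e′ = f≈e′
≈-trans (inj₂ refl) (inj₁ refl) = inj₂ refl
≈-trans (inj₂ refl) (inj₂ refl) = inj₁ refl

endpoint-resp-≈ : e ≈ f → Endpoint x e → Endpoint x f
endpoint-resp-≈ (inj₁ refl) x∈e = x∈e
endpoint-resp-≈ (inj₂ refl) x∈e = Sum.swap x∈e

Separated : Vertex n m → Vertex n m → Set
Separated x y = x ≢ y × ¬ Adj x y

separated? : Decidable (Separated {n} {m})
separated? x y = ¬? (x ≟ᵥ y) ×-dec ¬? (adj? x y)

-- The second half of IsInducedMatching M says precisely that entries at distinct
-- positions are Compatible.
Compatible : Edge n m → Edge n m → Set
Compatible {n} {m} e f = (x y : Vertex n m) → Endpoint x e → Endpoint y f → Separated x y

compatible-resp-≈ : e ≈ e′ → f ≈ f′ → Compatible e f → Compatible e′ f′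
compatible-resp-≈ e≈e′ f≈f′ e∥f x y x∈e′ y∈f′ =
  e∥f x y (endpoint-resp-≈ (≈-sym e≈e′) x∈e′) (endpoint-resp-≈ (≈-sym f≈f′) y∈f′)

compatible? : Decidable (Compatible {n} {m})
compatible? (x , y) (z , w) =
  map′ fromCorners toCorners
    (separated? x z ×-dec separated? x w ×-dec separated? y z ×-dec separated? y w)
  where
  fromCorners : Separated x z × Separated x w × Separated y z × Separated y w →
                Compatible (x , y) (z , w)
  fromCorners (xz , xw , yz , yw) _ _ (inj₁ refl) (inj₁ refl) = xz
  fromCorners (xz , xw , yz , yw) _ _ (inj₁ refl) (inj₂ refl) = xw
  fromCorners (xz , xw , yz , yw) _ _ (inj₂ refl) (inj₁ refl) = yz
  fromCorners (xz , xw , yz , yw) _ _ (inj₂ refl) (inj₂ refl) = yw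

  toCorners : Compatible (x , y) (z , w) →
              Separated x z × Separated x w × Separated y z × Separated y w
  toCorners c = c _ _ (inj₁ refl) (inj₁ refl) , c _ _ (inj₁ refl) (inj₂ refl)
              , c _ _ (inj₂ refl) (inj₁ refl) , c _ _ (inj₂ refl) (inj₂ refl)

isInducedMatching? : U.Decidable (IsInducedMatching {n} {m})
isInducedMatching? M =
  (all? λ p → adj? (proj₁ (lookup M p)) (proj₂ (lookup M p))) ×-dec
  (all? λ p → all? λ q → ¬? (p ≟ q) →-dec compatible? (lookup M p) (lookup M q))

infix 4 _⋖_
_⋖_ : Vertex n m → Vertex n m → Set
(i , j) ⋖ (k , l) = (i ≡ k × ℕ.suc (toℕ j) ≡ toℕ l) ⊎ (j ≡ l × ℕ.suc (toℕ i) ≡ toℕ k)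

_⋖?_ : Decidable (_⋖_ {n} {m})
(i , j) ⋖? (k , l) = ((i ≟ k) ×-dec (ℕ.suc (toℕ j) ℕ.≟ toℕ l)) ⊎-dec ((j ≟ l) ×-dec (ℕ.suc (toℕ i) ℕ.≟ toℕ k))

adj⇒⋖⊎⋗ : Adj x y → x ⋖ y ⊎ y ⋖ x
adj⇒⋖⊎⋗ (inj₁ (refl , inj₁ 1+j≡l)) = inj₁ (inj₁ (refl , 1+j≡l))
adj⇒⋖⊎⋗ (inj₁ (refl , inj₂ 1+l≡j)) = inj₂ (inj₁ (refl , 1+l≡j))
adj⇒⋖⊎⋗ (inj₂ (refl , inj₁ 1+i≡k)) = inj₁ (inj₂ (refl , 1+i≡k))
adj⇒⋖⊎⋗ (inj₂ (refl , inj₂ 1+k≡i)) = inj₂ (inj₂ (refl , 1+k≡i))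

⋖-asym : x ⋖ y → ¬ y ⋖ x
⋖-asym (inj₁ (refl , 1+j≡l)) (inj₁ (_ , 1+l≡j)) = <-asym (≤-reflexive 1+j≡l) (≤-reflexive 1+l≡j)
⋖-asym (inj₁ (refl , _)) (inj₂ (refl , 1+i≡i)) = 1+n≢n 1+i≡i
⋖-asym (inj₂ (refl , _)) (inj₁ (refl , 1+j≡j)) = 1+n≢n 1+j≡j
⋖-asym (inj₂ (refl , 1+i≡k)) (inj₂ (_ , 1+k≡i)) = <-asym (≤-reflexive 1+i≡k) (≤-reflexive 1+k≡i)

vertices : (n m : ℕ) → List (Vertex n m)
vertices n m = cartesianProduct (allFin n) (allFin m)

gridEdges : (n m : ℕ) → List (Edge n m)
gridEdges n m = filter (uncurry _⋖?_) (cartesianProduct (vertices n m) (vertices n m))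

∈-vertices : (x : Vertex n m) → x ∈ vertices n m
∈-vertices (i , j) = ∈-cartesianProduct⁺ (∈-allFin i) (∈-allFin j)

∈-gridEdges : x ⋖ y → (x , y) ∈ gridEdges n m
∈-gridEdges {x = x} {y} = ∈-filter⁺ (uncurry _⋖?_) (∈-cartesianProduct⁺ (∈-vertices x) (∈-vertices y))

gridEdges-complete : Adj x y → Any ((x , y) ≈_) (gridEdges n m)
gridEdges-complete xy with adj⇒⋖⊎⋗ xy
... | inj₁ x⋖y = lose (∈-gridEdges x⋖y) (inj₁ refl)
... | inj₂ y⋖x = lose (∈-gridEdges y⋖x) (inj₂ refl)

gridEdges-distinct : AllPairs (λ e f → ¬ e ≈ f) (gridEdges n m)
gridEdges-distinct {n} {m} =
  allPairs-zipWith-All oriented-distinct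
    (all-filter (uncurry _⋖?_) edgeCandidates)
    (Unique.filter⁺ (uncurry _⋖?_) (Unique.cartesianProduct⁺ uniqueVertices uniqueVertices))
  where
  edgeCandidates : List (Edge n m)
  edgeCandidates = cartesianProduct (vertices n m) (vertices n m)
  uniqueVertices : AllPairs _≢_ (vertices n m)
  uniqueVertices = Unique.cartesianProduct⁺ (Unique.allFin⁺ n) (Unique.allFin⁺ m)

  oriented-distinct : uncurry _⋖_ e → uncurry _⋖_ f → e ≢ f → ¬ e ≈ f
  oriented-distinct _ _ e≢f (inj₁ e≡f) = e≢f e≡f
  oriented-distinct x⋖y y⋖x _ (inj₂ refl) = ⋖-asym x⋖y y⋖x

module Representatives {n m : ℕ} (M : List (Edge n m)) (matching : IsInducedMatching M) where

  Represented : Edge n m → Set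
  Represented e = Any (_≈ e) M

  represented? : U.Decidable Represented
  represented? e = Any.any? (_≈? e) M

  representatives : List (Edge n m)
  representatives = filter represented? (gridEdges n m)

  representatives-⊆ : representatives ⊆ gridEdges n m
  representatives-⊆ = filter-⊆ represented? (gridEdges n m)

  covering : (p : Fin (length M)) → ∃[ e ] (e ∈ gridEdges n m × lookup M p ≈ e)
  covering p = find (gridEdges-complete (proj₁ matching p))

  representative : Fin (length M) → Edge n m
  representative p = proj₁ (covering p)

  ≈-representative : ∀ p → lookup M p ≈ representative p
  ≈-representative p = proj₂ (proj₂ (covering p))

  representative-∈ : ∀ p → representative p ∈ representatives
  representative-∈ p = ∈-filter⁺ represented? (proj₁ (proj₂ (covering p))) (lose (∈-lookup p) (≈-representative p))

  lookup-≈-injective : ∀ {p q} → lookup M p ≈ lookup M q → p ≡ q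
  lookup-≈-injective {p} {q} p≈q with p ≟ q
  ... | yes p≡q = p≡q
  ... | no p≢q = ⊥-elim (proj₁ (proj₂ matching p q p≢q _ _ (inj₁ refl) (endpoint-resp-≈ p≈q (inj₁ refl))) refl)

  length-≤-representatives : length M ≤ length representatives
  length-≤-representatives = injective⇒≤ position-injective
    where
    position : Fin (length M) → Fin (length representatives)
    position p = index (representative-∈ p)

    position-injective : ∀ {p q} → position p ≡ position q → p ≡ q
    position-injective {p} {q} same =
      lookup-≈-injective
        (≈-trans (≈-representative p) (subst (_≈ lookup M q) (sym p≡q) (≈-sym (≈-representative q))))
      where
      p≡q : representative p ≡ representative q
      p≡q = trans (lookup-index (representative-∈ p))
                  (trans (cong (lookup representatives) same) (sym (lookup-index (representative-∈ q))))

  saturated⇔ : Saturated M x ⇔ Saturated representatives x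
  saturated⇔ {x = x} = mk⇔ to from
    where
    to : Saturated M x → Saturated representatives x
    to x∈M = lose (representative-∈ p) (endpoint-resp-≈ (≈-representative p) (lookup-index x∈M))
      where
      p : Fin (length M)
      p = index x∈M

    from : Saturated representatives x → Saturated M x
    from x∈S with find x∈S
    ... | e , e∈S , x∈e =
      Any.map (λ h≈e → endpoint-resp-≈ (≈-sym h≈e) x∈e) (proj₂ (∈-filter⁻ represented? {xs = gridEdges n m} e∈S))

  represented-compatible : Represented e → Represented f → ¬ e ≈ f → Compatible e f
  represented-compatible {e = e} {f} he hf e≉f with index he ≟ index hf
  ... | yes same =
    ⊥-elim (e≉f (≈-trans (≈-sym (lookup-index he)) (subst (λ p → lookup M p ≈ f) (sym same) (lookup-index hf))))
  ... | no differ = compatible-resp-≈ (lookup-index he) (lookup-index hf) (proj₂ matching _ _ differ)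

  representatives-compatible : AllPairs Compatible representatives
  representatives-compatible =
    allPairs-zipWith-All represented-compatible (all-filter represented? (gridEdges n m))
      (AllPairs.filter⁺ represented? gridEdges-distinct)

SaturatesOnlyAdjacentPair : List (Edge n m) → Fin m → Set
SaturatesOnlyAdjacentPair {n} {m} M c =
  ∃[ a ] ∃[ b ] (Adj {n} {m} (a , c) (b , c) × Saturated M (a , c) × Saturated M (b , c) ×
    ((k : Fin n) → Saturated M (k , c) → k ≡ a ⊎ k ≡ b))

SaturatesThreeWithAdjacentPair : List (Edge n m) → Fin m → Set
SaturatesThreeWithAdjacentPair {n} {m} M c =
  ∃[ i ] ∃[ j ] ∃[ k ] (i ≢ j × i ≢ k × j ≢ k ×
    Saturated M (i , c) × Saturated M (j , c) × Saturated M (k , c) × Adj {n} {m} (i , c) (j , c))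

onlyAdjacentPair? : (M : List (Edge n m)) (c : Fin m) → Dec (SaturatesOnlyAdjacentPair M c)
onlyAdjacentPair? M c =
  any? λ a → any? λ b → adj? _ _ ×-dec saturated? M _ ×-dec saturated? M _ ×-dec
    all? (λ k → saturated? M _ →-dec ((k ≟ a) ⊎-dec (k ≟ b)))

threeWithAdjacentPair? : (M : List (Edge n m)) (c : Fin m) → Dec (SaturatesThreeWithAdjacentPair M c)
threeWithAdjacentPair? M c =
  any? λ i → any? λ j → any? λ k → ¬? (i ≟ j) ×-dec ¬? (i ≟ k) ×-dec ¬? (j ≟ k) ×-dec
    saturated? M _ ×-dec saturated? M _ ×-dec saturated? M _ ×-dec adj? _ _

onlyAdjacentPair-resp : {M N : List (Edge n m)} {c : Fin m} → (∀ {x} → Saturated M x ⇔ Saturated N x) →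
                        SaturatesOnlyAdjacentPair M c → SaturatesOnlyAdjacentPair N c
onlyAdjacentPair-resp same (a , b , ab , sa , sb , only) =
  a , b , ab , Equivalence.to same sa , Equivalence.to same sb , λ k sk → only k (Equivalence.from same sk)

threeWithAdjacentPair-mono : {M N : List (Edge n m)} {c : Fin m} → (∀ {x} → Saturated M x → Saturated N x) →
                             SaturatesThreeWithAdjacentPair M c → SaturatesThreeWithAdjacentPair N c
threeWithAdjacentPair-mono sub (i , j , k , i≢j , i≢k , j≢k , si , sj , sk , ij) =
  i , j , k , i≢j , i≢k , j≢k , sub si , sub sj , sub sk , ij

sixEdgeMatching : List (Edge 5 5)
sixEdgeMatching =
  ((# 0 , # 0) , (# 0 , # 1)) ∷ ((# 0 , # 3) , (# 0 , # 4)) ∷ ((# 1 , # 2) , (# 2 , # 2)) ∷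
  ((# 2 , # 0) , (# 3 , # 0)) ∷ ((# 2 , # 4) , (# 3 , # 4)) ∷ ((# 4 , # 1) , (# 4 , # 2)) ∷ []

sixEdgeMatching-induced : IsInducedMatching sixEdgeMatching
sixEdgeMatching-induced = from-yes (isInducedMatching? sixEdgeMatching)

PairInFirstColumn⇒TripleInLast : List (Edge 5 5) → Set
PairInFirstColumn⇒TripleInLast S =
  SaturatesOnlyAdjacentPair S (# 0) → SaturatesThreeWithAdjacentPair S (# 4)

pairInFirstColumn⇒tripleInLast? : U.Decidable PairInFirstColumn⇒TripleInLast
pairInFirstColumn⇒tripleInLast? S = onlyAdjacentPair? S (# 0) →-dec threeWithAdjacentPair? S (# 4)

open CliqueSearch compatible? pairInFirstColumn⇒tripleInLast? 6

-- Stated with ≡ true rather than T: refl evaluates the search once, whereas a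
-- T-valued type would be re-normalised at every comparison.
search-succeeds : searchFrom (gridEdges 5 5) ≡ true
search-succeeds = refl

lemma3p14 : (M : List (Edge 5 5)) → IsMaximumInducedMatching M →
    (∃[ a ] ∃[ b ] (Adj {5} {5} (a , zero) (b , zero) × Saturated M (a , zero) × Saturated M (b , zero) ×
      ((k : Fin 5) → Saturated M (k , zero) → k ≡ a ⊎ k ≡ b))) →
    ∃[ i ] ∃[ j ] ∃[ k ] (i ≢ j × i ≢ k × j ≢ k ×
      Saturated M (i , suc (suc (suc (suc zero)))) × Saturated M (j , suc (suc (suc (suc zero)))) × Saturated M (k , suc (suc (suc (suc zero)))) ×
      Adj {5} {5} (i , suc (suc (suc (suc zero)))) (j , suc (suc (suc (suc zero)))))
lemma3p14 M (matching , maximum) pairInFirstColumn =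
  threeWithAdjacentPair-mono (Equivalence.from saturated⇔)
    (firstToLastColumn (onlyAdjacentPair-resp saturated⇔ pairInFirstColumn))
  where
  open Representatives M matching

  six : 6 ≤ length representatives
  six = ≤-trans (maximum sixEdgeMatching sixEdgeMatching-induced) length-≤-representatives

  firstToLastColumn : PairInFirstColumn⇒TripleInLast representatives
  firstToLastColumn = searchFrom-sound representatives-⊆ representatives-compatible six search-succeeds
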